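{- Let $X,Y$ be sets and $M=M(X,Y)$. (1) $(M,\sqsubseteq_\downarrow,\Cup,1_\Cup,\Cap,1_\Cap)$ is a preordered commutative double monoid with least element $\emptyset$ and greatest element $U$. (2) $(M,\sqsubseteq_\uparrow,\Cup,1_\Cup,\Cap,1_\Cap)$ is a preordered commutative double monoid with least element $U$ and greatest element $\emptyset$. (3) $(M,\sqsubseteq_\updownarrow,\Cup,1_\Cup,\Cap,1_\Cap)$ is a preordered commutative double monoid. (4) Inner complementation is an order-reversing isomorphism of preordered double monoids (exchanging $\Cup,1_\Cup$ with $\Cap,1_\Cap$): for all $R,S\in M$, $R\sqsubseteq_\downarrow S\Leftrightarrow\widetilde{S}\sqsubseteq_\uparrow\widetilde{R}$, $R\sqsubseteq_\uparrow S\Leftrightarrow\widetilde{S}\sqsubseteq_\downarrow\widetilde{R}$ and $R\sqsubseteq_\updownarrow S\Leftrightarrow\widetilde{S}\sqsubseteq_\updownarrow\widetilde{R}$. (5) Each of $\sqsubseteq_\downarrow$, $\sqsubseteq_\uparrow$, $\sqsubseteq_\updownarrow$ is a precongruence with respect to $\cup$, $\uparrow$, $\downarrow$ and $\updownarrow$ (i.e. these operations are monotone with respect to it). (6) Peleg composition preserves $\sqsubseteq_\downarrow$, $\sqsubseteq_\uparrow$ and $\sqsubseteq_\updownarrow$ in its second argument: for $R:W\leftrightarrow\mathcal{P}X$ and $S,T\in M$, $S\sqsubseteq T$ implies $R\ast S\sqsubseteq R\ast T$ for each of these preorders $\sqsubseteq$.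
   Context: A multirelation is a relation $R\subseteq X\times\mathcal{P}Y$; $M(X,Y)$ is the set of all, $U=X\times\mathcal{P}Y$. Inner union $R\Cup S=\{(a,A\cup B)\mid (a,A)\in R\wedge (a,B)\in S\}$, inner intersection $R\Cap S=\{(a,A\cap B)\mid (a,A)\in R\wedge (a,B)\in S\}$, $1_\Cup=\{(a,\emptyset)\mid a\in X\}$, $1_\Cap=\{(a,Y)\mid a\in X\}$, inner complementation $\widetilde{R}=\{(a,Y\setminus A)\mid (a,A)\in R\}$. Inner closures: $\uparrow R=\{(a,A)\mid\exists B.\,(a,B)\in R\wedge B\subseteq A\}$, $\downarrow R=\{(a,A)\mid\exists B.\,(a,B)\in R\wedge A\subseteq B\}$, $\updownarrow R=\uparrow R\cap\downarrow R$. Preorders: $R\sqsubseteq_\uparrow S\Leftrightarrow S\subseteq\uparrow R$; $R\sqsubseteq_\downarrow S\Leftrightarrow R\subseteq\downarrow S$; $R\sqsubseteq_\updownarrow S\Leftrightarrow R\sqsubseteq_\downarrow S\wedge R\sqsubseteq_\uparrow S$. Peleg composition: for $R:W\leftrightarrow\mathcal{P}X$, $S:X\leftrightarrow\mathcal{P}Y$, $R\ast S=\{(a,C)\mid\exists B.\,(a,B)\in R\wedge\exists f:X\to\mathcal{P}Y.\,(\forall b\in B.\,(b,f(b))\in S)\wedge C=\bigcup_{b\in B}f(b)\}$. A preordered commutative double monoid is a set with a preorder and two commutative monoid structures whose multiplications are monotone in both arguments with respect to the preorder. -}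

module Defs where

import Level
open import Level using (Level; 0ℓ; _⊔_; Lift; lift) renaming (suc to lsuc)
open import Data.Product using (Σ; ∃; _×_; _,_)
open import Data.Sum using (_⊎_)
open import Data.Empty.Polymorphic using (⊥)
open import Data.Unit.Polymorphic using (⊤)
open import Relation.Unary using (Pred; _⊆_; _≐_; _∪_; _∩_; ∁) renaming (∅ to ∅ˢ; U to Uˢ)
open import Relation.Binary.Core using (Rel)
open import Relation.Binary.Structures using (IsPreorder)
open import Algebra.Core using (Op₂)
open import Algebra.Structures using (IsCommutativeMonoid)

-- Subsets of Y are predicates  Pred Y 0ℓ  (the power set 𝒫Y), compared by
-- extensional equality _≐_.  A multirelation R ⊆ X × 𝒫Y is a predicate on
-- pairs (a , A) which respects extensional equality of the subset A
-- (i.e. it is genuinely a set of pairs (element, subset)).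

𝒫 : Set → Set₁
𝒫 Y = Pred Y 0ℓ

record Multirel (X Y : Set) : Set₂ where
  constructor mkM
  field
    rel  : X → 𝒫 Y → Set₁
    resp : ∀ {a A B} → A ≐ B → rel a A → rel a B
open Multirel public

module _ {X Y : Set} where

  _⊆ᴹ_ : Multirel X Y → Multirel X Y → Set₁
  R ⊆ᴹ S = ∀ {a A} → rel R a A → rel S a A

  _≋_ : Multirel X Y → Multirel X Y → Set₁
  R ≋ S = (R ⊆ᴹ S) × (S ⊆ᴹ R)

  ∅ᴹ : Multirel X Y
  ∅ᴹ = mkM (λ _ _ → ⊥) (λ _ ())

  Uᴹ : Multirel X Y
  Uᴹ = mkM (λ _ _ → ⊤) (λ _ t → t)

  _∪ᴹ_ : Multirel X Y → Multirel X Y → Multirel X Y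
  R ∪ᴹ S = mkM (λ a C → rel R a C ⊎ rel S a C)
               (λ { e (Data.Sum.inj₁ r) → Data.Sum.inj₁ (resp R e r)
                  ; e (Data.Sum.inj₂ s) → Data.Sum.inj₂ (resp S e s) })

  private
    ≐-trans : {A B C : 𝒫 Y} → A ≐ B → B ≐ C → A ≐ C
    ≐-trans (p , q) (r , s) = (λ x → r (p x)) , (λ x → q (s x))
    ≐-sym : {A B : 𝒫 Y} → A ≐ B → B ≐ A
    ≐-sym (p , q) = q , p

  _⋓_ : Multirel X Y → Multirel X Y → Multirel X Y
  R ⋓ S = mkM (λ a C → Σ (𝒫 Y) λ A → Σ (𝒫 Y) λ B →
                          rel R a A × rel S a B × (C ≐ (A ∪ B)))
              (λ e (A , B , r , s , c) → A , B , r , s , ≐-trans (≐-sym e) c)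

  _⋒_ : Multirel X Y → Multirel X Y → Multirel X Y
  R ⋒ S = mkM (λ a C → Σ (𝒫 Y) λ A → Σ (𝒫 Y) λ B →
                          rel R a A × rel S a B × (C ≐ (A ∩ B)))
              (λ e (A , B , r , s , c) → A , B , r , s , ≐-trans (≐-sym e) c)

  1⋓ : Multirel X Y
  1⋓ = mkM (λ a C → Lift (Level.suc 0ℓ) (C ≐ ∅ˢ)) (λ e (lift c) → lift (≐-trans (≐-sym e) c))

  1⋒ : Multirel X Y
  1⋒ = mkM (λ a C → Lift (Level.suc 0ℓ) (C ≐ Uˢ)) (λ e (lift c) → lift (≐-trans (≐-sym e) c))

  ∼_ : Multirel X Y → Multirel X Y
  ∼ R = mkM (λ a C → Σ (𝒫 Y) λ A → rel R a A × (C ≐ ∁ A))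
            (λ e (A , r , c) → A , r , ≐-trans (≐-sym e) c)

  ↑ᴹ : Multirel X Y → Multirel X Y
  ↑ᴹ R = mkM (λ a A → Σ (𝒫 Y) λ B → rel R a B × (B ⊆ A))
             (λ (p , q) (B , r , s) → B , r , (λ x → p (s x)))

  ↓ᴹ : Multirel X Y → Multirel X Y
  ↓ᴹ R = mkM (λ a A → Σ (𝒫 Y) λ B → rel R a B × (A ⊆ B))
             (λ (p , q) (B , r , s) → B , r , (λ x → s (q x)))

  ↕ᴹ : Multirel X Y → Multirel X Y
  ↕ᴹ R = mkM (λ a A → rel (↑ᴹ R) a A × rel (↓ᴹ R) a A)
             (λ e (u , d) → resp (↑ᴹ R) e u , resp (↓ᴹ R) e d)

  _⊑↑_ : Multirel X Y → Multirel X Y → Set₁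
  R ⊑↑ S = S ⊆ᴹ ↑ᴹ R

  _⊑↓_ : Multirel X Y → Multirel X Y → Set₁
  R ⊑↓ S = R ⊆ᴹ ↓ᴹ S

  _⊑↕_ : Multirel X Y → Multirel X Y → Set₁
  R ⊑↕ S = (R ⊑↓ S) × (R ⊑↑ S)

_✱_ : {W X Y : Set} → Multirel W X → Multirel X Y → Multirel W Y
_✱_ {W} {X} {Y} R S =
  mkM (λ a C → Σ (𝒫 X) λ B → rel R a B × Σ (X → 𝒫 Y) λ f →
                 (∀ b → B b → rel S b (f b)) × (C ≐ (λ y → ∃ λ b → B b × f b y)))
      (λ { (p , q) (B , r , f , s , (c₁ , c₂)) →
             B , r , f , s , ((λ x → c₁ (q x)) , (λ x → p (c₂ x))) })

record IsPreorderedCommDoubleMonoid {c ℓ₁ ℓ₂ : Level} {A : Set c}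
       (_≈_ : Rel A ℓ₁) (_≤_ : Rel A ℓ₂)
       (_∙_ : Op₂ A) (ε : A) (_∘_ : Op₂ A) (ι : A) : Set (c ⊔ ℓ₁ ⊔ ℓ₂) where
  field
    isPreorder   : IsPreorder _≈_ _≤_
    ∙-isCommMon  : IsCommutativeMonoid _≈_ _∙_ ε
    ∘-isCommMon  : IsCommutativeMonoid _≈_ _∘_ ι
    ∙-mono       : ∀ {x x′ y y′} → x ≤ x′ → y ≤ y′ → (x ∙ y) ≤ (x′ ∙ y′)
    ∘-mono       : ∀ {x x′ y y′} → x ≤ x′ → y ≤ y′ → (x ∘ y) ≤ (x′ ∘ y′)

Monotone₁ : {c ℓ : Level} {A : Set c} → Rel A ℓ → (A → A) → Set (c ⊔ ℓ)
Monotone₁ _≤_ f = ∀ {x y} → x ≤ y → f x ≤ f y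

Monotone₂ : {c ℓ : Level} {A : Set c} → Rel A ℓ → Op₂ A → Set (c ⊔ ℓ)
Monotone₂ _≤_ _∙_ = ∀ {x x′ y y′} → x ≤ x′ → y ≤ y′ → (x ∙ y) ≤ (x′ ∙ y′)

open import Function.Bundles using (_⇔_)
open import Axiom.ExcludedMiddle using (ExcludedMiddle)

module _ (X Y : Set) where

  Part1 : Set₂
  Part1 = IsPreorderedCommDoubleMonoid {A = Multirel X Y} _≋_ _⊑↓_ _⋓_ 1⋓ _⋒_ 1⋒
          × (∀ (R : Multirel X Y) → ∅ᴹ ⊑↓ R) × (∀ (R : Multirel X Y) → R ⊑↓ Uᴹ)

  Part2 : Set₂
  Part2 = IsPreorderedCommDoubleMonoid {A = Multirel X Y} _≋_ _⊑↑_ _⋓_ 1⋓ _⋒_ 1⋒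
          × (∀ (R : Multirel X Y) → Uᴹ ⊑↑ R) × (∀ (R : Multirel X Y) → R ⊑↑ ∅ᴹ)

  Part3 : Set₂
  Part3 = IsPreorderedCommDoubleMonoid {A = Multirel X Y} _≋_ _⊑↕_ _⋓_ 1⋓ _⋒_ 1⋒

  Part4 : Set₂
  Part4 = (∀ {R S : Multirel X Y} → R ≋ S → (∼ R) ≋ (∼ S))
        × (∀ (R : Multirel X Y) → (∼ (∼ R)) ≋ R)
        × (∀ (R S : Multirel X Y) → (∼ (R ⋓ S)) ≋ ((∼ R) ⋒ (∼ S)))
        × (∀ (R S : Multirel X Y) → (∼ (R ⋒ S)) ≋ ((∼ R) ⋓ (∼ S)))
        × ((∼ (1⋓ {X} {Y})) ≋ 1⋒)
        × ((∼ (1⋒ {X} {Y})) ≋ 1⋓)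
        × (∀ (R S : Multirel X Y) →
             ((R ⊑↓ S) ⇔ ((∼ S) ⊑↑ (∼ R)))
           × ((R ⊑↑ S) ⇔ ((∼ S) ⊑↓ (∼ R)))
           × ((R ⊑↕ S) ⇔ ((∼ S) ⊑↕ (∼ R))))

  Precongruence : (Multirel X Y → Multirel X Y → Set₁) → Set₂
  Precongruence _⊑_ = Monotone₂ _⊑_ _∪ᴹ_ × Monotone₁ _⊑_ ↑ᴹ
                    × Monotone₁ _⊑_ ↓ᴹ × Monotone₁ _⊑_ ↕ᴹ

  Part5 : Set₂
  Part5 = Precongruence _⊑↓_ × Precongruence _⊑↑_ × Precongruence _⊑↕_

Part6 : Set₂
Part6 = ∀ (W X Y : Set) (R : Multirel W X) {S T : Multirel X Y} →
          ((S ⊑↓ T) → ((R ✱ S) ⊑↓ (R ✱ T)))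
        × ((S ⊑↑ T) → ((R ✱ S) ⊑↑ (R ✱ T)))
        × ((S ⊑↕ T) → ((R ✱ S) ⊑↕ (R ✱ T)))

-- Both preorders lift a preorder ≤ on subsets: P is below Q when every
-- (a , A) ∈ P has some (a , B) ∈ Q with A ≤ B.  R ⊑↓ S lifts ⊆ from R to S and
-- R ⊑↑ S lifts ⊇ from S to R, so each monotonicity property is proved once for
-- an arbitrary ≤ and used with ⊆ and with ⊇, while ⊑↕ is their intersection.
-- The inner operations lift the commutative monoids (𝒫 Y, ∪, ∅) and (𝒫 Y, ∩, Y),
-- and inner complementation lifts ∁, an antitone involution exchanging ∪ and ∩
-- (classically), which turns liftings of ⊆ into liftings of ⊇.  Peleg
-- composition is monotone because the witnesses found for the b ∈ B assemble
-- into a new family f; extending it off B uses excluded middle.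

module Submission where

open import Defs
open import Axiom.DoubleNegationElimination using (em⇒dne)
open import Axiom.ExcludedMiddle using (ExcludedMiddle)
open import Algebra.Core using (Op₂)
open import Algebra.Structures using (IsCommutativeMonoid)
open import Algebra.Structures.Biased using (isCommutativeMonoidˡ)
open import Data.Empty using (⊥-elim)
open import Data.Product using (Σ; ∃; _×_; _,_; proj₁; proj₂)
import Data.Product as Product
open import Data.Sum using (inj₁; inj₂; [_,_])
import Data.Sum as Sum
open import Data.Unit using (tt)
open import Function using (id; flip)
open import Function.Bundles using (mk⇔)
open import Level using (Level; 0ℓ; Lift; lift) renaming (suc to lsuc)
open import Relation.Binary.Core using (Rel; _⇒_; _⇔_)
open import Relation.Binary.Structures using (IsEquivalence; IsPreorder)
import Relation.Binary.Construct.Flip.EqAndOrd as Flip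
import Relation.Binary.Construct.Intersection as Intersection
open Intersection using () renaming (_∩_ to _∩₂_)
open import Relation.Binary.Construct.Union using () renaming (_∪_ to _∪₂_)
open import Relation.Nullary using (yes; no)
open import Relation.Unary using (Pred; _⊆_; _≐_; _∪_; _∩_; ∁) renaming (∅ to ∅ˢ; U to Uˢ)
open import Relation.Unary.Properties using (≐-refl; ≐-sym; ≐-trans)
open import Relation.Unary.Algebra using (∪-cong; ∪-comm; ∪-assoc; ∩-cong; ∩-comm; ∩-assoc)
open import Relation.Unary.Relation.Binary.Subset using (⊆-isPreorder)

-- The lemmas are stated for bare membership relations, to which  rel R  of a
-- multirelation R reduces definitionally: R ⊑↓ S is  Lifting _⊆_ (rel R) (rel S),
-- R ⊑↑ S is  Lifting _⊇_ (rel S) (rel R),  rel (R ⋓ S) is  Inner _∪_ (rel R) (rel S),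
-- rel (∼ R) is  Image ∁ (rel R)  and  rel (R ✱ S) is  Peleg (rel R) (rel S).
MRel : Set → Set → Set₂
MRel X Y = X → 𝒫 Y → Set₁

⋃ : {X Y : Set} → 𝒫 X → (X → 𝒫 Y) → 𝒫 Y
⋃ B f y = ∃ λ b → B b × f b y

module _ {X Y : Set} where

  Below : Rel (𝒫 Y) 0ℓ → MRel X Y → MRel X Y
  Below _≤_ P a A = Σ (𝒫 Y) λ B → P a B × A ≤ B

  Lifting : Rel (𝒫 Y) 0ℓ → MRel X Y → MRel X Y → Set₁
  Lifting _≤_ P Q = P ⇒ Below _≤_ Q

  Inner : Op₂ (𝒫 Y) → MRel X Y → MRel X Y → MRel X Y
  Inner _•_ P Q a C = Σ (𝒫 Y) λ A → Σ (𝒫 Y) λ B → P a A × Q a B × C ≐ A • B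

  Constant : 𝒫 Y → MRel X Y
  Constant e a C = Lift (lsuc 0ℓ) (C ≐ e)

  Image : (𝒫 Y → 𝒫 Y) → MRel X Y → MRel X Y
  Image φ P a C = Σ (𝒫 Y) λ A → P a A × C ≐ φ A

Peleg : {W X Y : Set} → MRel W X → MRel X Y → MRel W Y
Peleg {X = X} {Y} P Q a C =
  Σ (𝒫 X) λ B → P a B × Σ (X → 𝒫 Y) λ f → (∀ b → B b → Q b (f b)) × C ≐ ⋃ B f

module _ {X Y : Set} where

  ≋-isEquivalence : IsEquivalence (_≋_ {X} {Y})
  ≋-isEquivalence = record
    { refl  = id , id
    ; sym   = Product.swap
    ; trans = λ (R⊆S , S⊆R) (S⊆T , T⊆S) → (λ r → S⊆T (R⊆S r)) , (λ t → S⊆R (T⊆S t))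
    }

module _ {Y : Set} {A A′ B B′ : 𝒫 Y} where

  ∪-mono-⊆ : A ⊆ A′ → B ⊆ B′ → A ∪ B ⊆ A′ ∪ B′
  ∪-mono-⊆ A⊆A′ B⊆B′ = Sum.map A⊆A′ B⊆B′

  ∩-mono-⊆ : A ⊆ A′ → B ⊆ B′ → A ∩ B ⊆ A′ ∩ B′
  ∩-mono-⊆ A⊆A′ B⊆B′ = Product.map A⊆A′ B⊆B′

-- Relation.Unary.Algebra states these for the universe-polymorphic ∅ and U,
-- which differ definitionally from the ∅ and U of Relation.Unary used in Defs.
module _ {Y : Set} (A : 𝒫 Y) where

  ∅-∪-identityˡ : ∅ˢ ∪ A ≐ A
  ∅-∪-identityˡ = [ (λ ()) , id ] , inj₂

  U-∩-identityˡ : Uˢ ∩ A ≐ A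
  U-∩-identityˡ = proj₂ , (tt ,_)

⋃-mono-⊆ : {X Y : Set} {B : 𝒫 X} {f g : X → 𝒫 Y} →
           (∀ b → B b → f b ⊆ g b) → ⋃ B f ⊆ ⋃ B g
⋃-mono-⊆ f⊆g (b , b∈B , y∈fb) = b , b∈B , f⊆g b b∈B y∈fb

∁-antitone : {Y : Set} {A B : 𝒫 Y} → A ⊆ B → ∁ B ⊆ ∁ A
∁-antitone A⊆B ∉B x∈A = ∉B (A⊆B x∈A)

module _ {Y : Set} {A B : 𝒫 Y} where

  ∁-cong : A ≐ B → ∁ A ≐ ∁ B
  ∁-cong (A⊆B , B⊆A) = ∁-antitone {A = B} {A} B⊆A , ∁-antitone {A = A} {B} A⊆B

  ∁-∪ : ∁ (A ∪ B) ≐ ∁ A ∩ ∁ B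
  ∁-∪ = (λ ∉A∪B → (λ x∈A → ∉A∪B (inj₁ x∈A)) , (λ x∈B → ∉A∪B (inj₂ x∈B)))
      , (λ (∉A , ∉B) → [ ∉A , ∉B ])

module _ {Y : Set} where

  ∁-∅ : ∁ ∅ˢ ≐ Uˢ {A = Y}
  ∁-∅ = (λ _ → tt) , (λ _ ())

  ∁-U : ∁ Uˢ ≐ ∅ˢ {A = Y}
  ∁-U = (λ ∉U → ∉U tt) , (λ ())

module _ (em : ExcludedMiddle 0ℓ) {Y : Set} where

  ∁-reflects-⊆ : {A B : 𝒫 Y} → ∁ B ⊆ ∁ A → A ⊆ B
  ∁-reflects-⊆ ∁B⊆∁A x∈A = em⇒dne em (λ ∉B → ∁B⊆∁A ∉B x∈A)

  ∁-involutive : {A : 𝒫 Y} → ∁ (∁ A) ≐ A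
  ∁-involutive = em⇒dne em , (λ x∈A ∉A → ∉A x∈A)

  ∁-∩ : {A B : 𝒫 Y} → ∁ (A ∩ B) ≐ ∁ A ∪ ∁ B
  ∁-∩ {A} {B} = split , [ (λ ∉A (x∈A , _) → ∉A x∈A) , (λ ∉B (_ , x∈B) → ∉B x∈B) ]
    where
    split : ∁ (A ∩ B) ⊆ ∁ A ∪ ∁ B
    split {x} ∉A∩B with em {A x}
    ... | yes x∈A = inj₂ (λ x∈B → ∉A∩B (x∈A , x∈B))
    ... | no  ∉A  = inj₁ ∉A

module _ {X Y : Set} {_•_ : Op₂ (𝒫 Y)} where

  open import Algebra.Definitions (_≐_ {A = Y} {0ℓ} {0ℓ})
    using (Congruent₂; Commutative; Associative; LeftIdentity)
  open import Relation.Binary.Definitions using (_Respects_)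

  inner-map : {P P′ Q Q′ : MRel X Y} → P ⇒ P′ → Q ⇒ Q′ → Inner _•_ P Q ⇒ Inner _•_ P′ Q′
  inner-map P⇒P′ Q⇒Q′ (A , B , p , q , C≐A•B) = A , B , P⇒P′ p , Q⇒Q′ q , C≐A•B

  inner-cong : {P P′ Q Q′ : MRel X Y} → P ⇔ P′ → Q ⇔ Q′ → Inner _•_ P Q ⇔ Inner _•_ P′ Q′
  inner-cong {P} {P′} {Q} {Q′} (P⇒P′ , P′⇒P) (Q⇒Q′ , Q′⇒Q) =
    inner-map {P} {P′} {Q} {Q′} P⇒P′ Q⇒Q′ , inner-map {P′} {P} {Q′} {Q} P′⇒P Q′⇒Q

  inner-comm : Commutative _•_ → {P Q : MRel X Y} → Inner _•_ P Q ⇒ Inner _•_ Q P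
  inner-comm comm (A , B , p , q , C≐A•B) = B , A , q , p , ≐-trans C≐A•B (comm A B)

  module _ (cong : Congruent₂ _•_) where

    inner-assoc : Associative _•_ → {P Q S : MRel X Y} →
                  Inner _•_ (Inner _•_ P Q) S ⇔ Inner _•_ P (Inner _•_ Q S)
    inner-assoc assoc =
        (λ (D , C , (A , B , p , q , D≐A•B) , s , E≐D•C) →
           A , B • C , p , (B , C , q , s , ≐-refl)
             , ≐-trans E≐D•C (≐-trans (cong D≐A•B ≐-refl) (assoc A B C)))
      , (λ (A , D , p , (B , C , q , s , D≐B•C) , E≐A•D) →
           A • B , C , (A , B , p , q , ≐-refl) , s
             , ≐-trans E≐A•D (≐-trans (cong ≐-refl D≐B•C) (≐-sym (assoc A B C))))

    inner-identityˡ : {e : 𝒫 Y} → LeftIdentity e _•_ → {P : MRel X Y} →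
                      (∀ {a} → P a Respects _≐_) → Inner _•_ (Constant e) P ⇔ P
    inner-identityˡ identityˡ P-resp =
        (λ (E , A , lift E≐e , p , C≐E•A) →
           P-resp (≐-sym (≐-trans C≐E•A (≐-trans (cong E≐e ≐-refl) (identityˡ A)))) p)
      , (λ {_} {C} p → _ , C , lift ≐-refl , p , ≐-sym (identityˡ C))

module _ {X Y : Set} {φ : 𝒫 Y → 𝒫 Y} (φ-cong : ∀ {A B} → A ≐ B → φ A ≐ φ B) where

  open import Algebra.Definitions (_≐_ {A = Y} {0ℓ} {0ℓ}) using (Congruent₂)
  open import Relation.Binary.Definitions using (_Respects_)

  image-map : {P Q : MRel X Y} → P ⇒ Q → Image φ P ⇒ Image φ Q
  image-map P⇒Q (A , p , C≐φA) = A , P⇒Q p , C≐φA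

  image-involutive : (∀ A → φ (φ A) ≐ A) → {P : MRel X Y} →
                     (∀ {a} → P a Respects _≐_) → Image φ (Image φ P) ⇔ P
  image-involutive φφ≐id P-resp =
      (λ (C′ , (A , p , C′≐φA) , C≐φC′) →
         P-resp (≐-sym (≐-trans C≐φC′ (≐-trans (φ-cong C′≐φA) (φφ≐id A)))) p)
    , (λ {_} {C} p → φ C , (C , p , ≐-refl) , ≐-sym (φφ≐id C))

  image-inner : {_•_ _∘_ : Op₂ (𝒫 Y)} → (∀ A B → φ (A • B) ≐ φ A ∘ φ B) → Congruent₂ _∘_ →
                {P Q : MRel X Y} → Image φ (Inner _•_ P Q) ⇔ Inner _∘_ (Image φ P) (Image φ Q)
  image-inner {_•_} φ-hom ∘-cong =
      (λ (D , (A , B , p , q , D≐A•B) , C≐φD) →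
         φ A , φ B , (A , p , ≐-refl) , (B , q , ≐-refl)
           , ≐-trans C≐φD (≐-trans (φ-cong D≐A•B) (φ-hom A B)))
    , (λ (A′ , B′ , (A , p , A′≐φA) , (B , q , B′≐φB) , C≐A′∘B′) →
         A • B , (A , B , p , q , ≐-refl)
           , ≐-trans C≐A′∘B′ (≐-trans (∘-cong A′≐φA B′≐φB) (≐-sym (φ-hom A B))))

  image-constant : {e e′ : 𝒫 Y} → φ e ≐ e′ → Image φ (Constant {X} e) ⇔ Constant e′
  image-constant φe≐e′ =
      (λ (A , lift A≐e , C≐φA) → lift (≐-trans C≐φA (≐-trans (φ-cong A≐e) φe≐e′)))
    , (λ (lift C≐e′) → _ , lift ≐-refl , ≐-trans C≐e′ (≐-sym φe≐e′))

choose-on : ExcludedMiddle 0ℓ → {c p : Level} {A : Set} {B : Pred A 0ℓ} {C : Set c} {P : A → C → Set p} →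
            C → (∀ a → B a → Σ C (P a)) → Σ (A → C) λ g → ∀ a → B a → P a (g a)
choose-on em {A = A} {B} {C} {P} c₀ choice = g , g-spec
  where
  g : A → C
  g a with em {B a}
  ... | yes a∈B = proj₁ (choice a a∈B)
  ... | no  _   = c₀
  g-spec : ∀ a → B a → P a (g a)
  g-spec a a∈B with em {B a}
  ... | yes a∈B′ = proj₂ (choice a a∈B′)
  ... | no  a∉B  = ⊥-elim (a∉B a∈B)

module LiftingProperties {Y : Set} {_≤_ : Rel (𝒫 Y) 0ℓ} (≤-isPreorder : IsPreorder _≐_ _≤_) where

  open IsPreorder ≤-isPreorder using (reflexive) renaming (refl to ≤-refl; trans to ≤-trans)

  module _ {X : Set} where

    lifting-reflexive : {P Q : MRel X Y} → P ⇒ Q → Lifting _≤_ P Q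
    lifting-reflexive P⇒Q p = _ , P⇒Q p , ≤-refl

    lifting-refl : {P : MRel X Y} → Lifting _≤_ P P
    lifting-refl p = _ , p , ≤-refl

    lifting-trans : {P Q S : MRel X Y} → Lifting _≤_ P Q → Lifting _≤_ Q S → Lifting _≤_ P S
    lifting-trans P≤Q Q≤S p =
      let (B , q , A≤B) = P≤Q p ; (D , s , B≤D) = Q≤S q in D , s , ≤-trans A≤B B≤D

    lifting-isPreorder : IsPreorder {A = Multirel X Y} _≋_ (λ R S → Lifting _≤_ (rel R) (rel S))
    lifting-isPreorder = record
      { isEquivalence = ≋-isEquivalence
      ; reflexive     = λ {R} {S} (R⊆S , _) → lifting-reflexive {rel R} {rel S} R⊆S
      ; trans         = lifting-trans
      }

    lifting-to-Uᴹ : {P : MRel X Y} → Lifting _≤_ P (rel Uᴹ)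
    lifting-to-Uᴹ p = _ , _ , ≤-refl

    ∪₂-lifting-mono : {P P′ Q Q′ : MRel X Y} → Lifting _≤_ P P′ → Lifting _≤_ Q Q′ →
                      Lifting _≤_ (P ∪₂ Q) (P′ ∪₂ Q′)
    ∪₂-lifting-mono P≤P′ Q≤Q′ (inj₁ p) = Product.map₂ (Product.map₁ inj₁) (P≤P′ p)
    ∪₂-lifting-mono P≤P′ Q≤Q′ (inj₂ q) = Product.map₂ (Product.map₁ inj₂) (Q≤Q′ q)

    below-flip-lifting-mono : (∀ A B → Σ (𝒫 Y) λ D → A ≤ D × B ≤ D) → {P Q : MRel X Y} →
                      Lifting _≤_ P Q → Lifting _≤_ (Below (flip _≤_) P) (Below (flip _≤_) Q)
    below-flip-lifting-mono upper-bound P≤Q {_} {A} (B , p , B≤A) =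
      let (B′ , q , B≤B′) = P≤Q p ; (D , A≤D , B′≤D) = upper-bound A B′
      in D , (B′ , q , B′≤D) , A≤D

    inner-lifting-mono : {_•_ : Op₂ (𝒫 Y)} → (∀ {A A′ B B′} → A ≤ A′ → B ≤ B′ → (A • B) ≤ (A′ • B′)) →
                         {P P′ Q Q′ : MRel X Y} → Lifting _≤_ P P′ → Lifting _≤_ Q Q′ →
                         Lifting _≤_ (Inner _•_ P Q) (Inner _•_ P′ Q′)
    inner-lifting-mono {_•_} •-mono P≤P′ Q≤Q′ (A , B , p , q , C≐A•B) =
      let (A′ , p′ , A≤A′) = P≤P′ p ; (B′ , q′ , B≤B′) = Q≤Q′ q
      in A′ • B′ , (A′ , B′ , p′ , q′ , ≐-refl) , ≤-trans (reflexive C≐A•B) (•-mono A≤A′ B≤B′)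

    module _ {φ : 𝒫 Y → 𝒫 Y} {P Q : MRel X Y} where

      image-lifting-antitone : (∀ {A B} → A ≤ B → φ B ≤ φ A) →
                               Lifting _≤_ P Q → Lifting (flip _≤_) (Image φ P) (Image φ Q)
      image-lifting-antitone φ-antitone P≤Q (A , p , C≐φA) =
        let (B , q , A≤B) = P≤Q p
        in φ B , (B , q , ≐-refl) , ≤-trans (φ-antitone A≤B) (reflexive (≐-sym C≐φA))

      image-lifting-reflects : (∀ {A B} → φ B ≤ φ A → A ≤ B) →
                               Lifting (flip _≤_) (Image φ P) (Image φ Q) → Lifting _≤_ P Q
      image-lifting-reflects φ-reflects φP≥φQ p =
        let (D , (B , q , D≐φB) , D≤φA) = φP≥φQ (_ , p , ≐-refl)
        in B , q , φ-reflects (≤-trans (reflexive (≐-sym D≐φB)) D≤φA)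

  module _ {W X : Set} (em : ExcludedMiddle 0ℓ)
           (⋃-mono : ∀ {B : 𝒫 X} {f g : X → 𝒫 Y} → (∀ b → B b → f b ≤ g b) → ⋃ B f ≤ ⋃ B g) where

    peleg-lifting-mono : {P : MRel W X} {Q Q′ : MRel X Y} →
                         Lifting _≤_ Q Q′ → Lifting _≤_ (Peleg P Q) (Peleg P Q′)
    peleg-lifting-mono Q≤Q′ (B , p , f , q , C≐⋃f) =
      let (g , g-spec) = choose-on em ∅ˢ (λ b b∈B → Q≤Q′ (q b b∈B))
      in ⋃ B g , (B , p , g , (λ b b∈B → proj₁ (g-spec b b∈B)) , ≐-refl)
               , ≤-trans (reflexive C≐⋃f) (⋃-mono (λ b b∈B → proj₂ (g-spec b b∈B)))

module _ {c ℓ₁ ℓ₂ : Level} {A : Set c} {_≈_ : Rel A ℓ₁} {_⊑_ : Rel A ℓ₂} where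

  id-equivalent⇒monotone : IsPreorder _≈_ _⊑_ → {f : A → A} →
                           (∀ x → f x ⊑ x) → (∀ x → x ⊑ f x) → Monotone₁ _⊑_ f
  id-equivalent⇒monotone ⊑-isPreorder fx⊑x x⊑fx {x} {y} x⊑y =
    trans (fx⊑x x) (trans x⊑y (x⊑fx y))
    where open IsPreorder ⊑-isPreorder

module _ {c ℓ : Level} {A : Set c} {_⊑₁_ _⊑₂_ : Rel A ℓ} where

  monotone₁-∩ : {f : A → A} → Monotone₁ _⊑₁_ f → Monotone₁ _⊑₂_ f → Monotone₁ (_⊑₁_ ∩₂ _⊑₂_) f
  monotone₁-∩ f-mono₁ f-mono₂ (x⊑₁y , x⊑₂y) = f-mono₁ x⊑₁y , f-mono₂ x⊑₂y

  monotone₂-∩ : {_∙_ : Op₂ A} → Monotone₂ _⊑₁_ _∙_ → Monotone₂ _⊑₂_ _∙_ →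
                Monotone₂ (_⊑₁_ ∩₂ _⊑₂_) _∙_
  monotone₂-∩ ∙-mono₁ ∙-mono₂ (x⊑₁x′ , x⊑₂x′) (y⊑₁y′ , y⊑₂y′) =
    ∙-mono₁ x⊑₁x′ y⊑₁y′ , ∙-mono₂ x⊑₂x′ y⊑₂y′

module _ {X Y : Set} where

  precongruence-∩ : {_⊑₁_ _⊑₂_ : Rel (Multirel X Y) (lsuc 0ℓ)} →
                    Precongruence X Y _⊑₁_ → Precongruence X Y _⊑₂_ →
                    Precongruence X Y (_⊑₁_ ∩₂ _⊑₂_)
  precongruence-∩ {_⊑₁_} {_⊑₂_}
    (∪-mono₁ , ↑-mono₁ , ↓-mono₁ , ↕-mono₁) (∪-mono₂ , ↑-mono₂ , ↓-mono₂ , ↕-mono₂) =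
      monotone₂-∩ {_⊑₁_ = _⊑₁_} {_⊑₂_} {_∪ᴹ_} ∪-mono₁ ∪-mono₂
    , monotone₁-∩ {_⊑₁_ = _⊑₁_} {_⊑₂_} {↑ᴹ} ↑-mono₁ ↑-mono₂
    , monotone₁-∩ {_⊑₁_ = _⊑₁_} {_⊑₂_} {↓ᴹ} ↓-mono₁ ↓-mono₂
    , monotone₁-∩ {_⊑₁_ = _⊑₁_} {_⊑₂_} {↕ᴹ} ↕-mono₁ ↕-mono₂

  ⋓-isCommutativeMonoid : IsCommutativeMonoid (_≋_ {X} {Y}) _⋓_ 1⋓
  ⋓-isCommutativeMonoid = isCommutativeMonoidˡ record
    { isSemigroup = record
      { isMagma = record { isEquivalence = ≋-isEquivalence ; ∙-cong = inner-cong }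
      ; assoc   = λ _ _ _ → inner-assoc ∪-cong ∪-assoc
      }
    ; identityˡ = λ R → inner-identityˡ ∪-cong ∅-∪-identityˡ (resp R)
    ; comm      = λ R S → inner-comm ∪-comm {rel R} {rel S} , inner-comm ∪-comm {rel S} {rel R}
    }

  ⋒-isCommutativeMonoid : IsCommutativeMonoid (_≋_ {X} {Y}) _⋒_ 1⋒
  ⋒-isCommutativeMonoid = isCommutativeMonoidˡ record
    { isSemigroup = record
      { isMagma = record { isEquivalence = ≋-isEquivalence ; ∙-cong = inner-cong }
      ; assoc   = λ _ _ _ → inner-assoc ∩-cong ∩-assoc
      }
    ; identityˡ = λ R → inner-identityˡ ∩-cong U-∩-identityˡ (resp R)
    ; comm      = λ R S → inner-comm ∩-comm {rel R} {rel S} , inner-comm ∩-comm {rel S} {rel R}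
    }

  isPreorderedCommDoubleMonoid : {_⊑_ : Rel (Multirel X Y) (lsuc 0ℓ)} → IsPreorder _≋_ _⊑_ →
                                 Monotone₂ _⊑_ _⋓_ → Monotone₂ _⊑_ _⋒_ →
                                 IsPreorderedCommDoubleMonoid _≋_ _⊑_ _⋓_ 1⋓ _⋒_ 1⋒
  isPreorderedCommDoubleMonoid ⊑-isPreorder ⋓-mono ⋒-mono = record
    { isPreorder  = ⊑-isPreorder
    ; ∙-isCommMon = ⋓-isCommutativeMonoid
    ; ∘-isCommMon = ⋒-isCommutativeMonoid
    ; ∙-mono      = ⋓-mono
    ; ∘-mono      = ⋒-mono
    }

  isPreorderedCommDoubleMonoid-∩ : {_⊑₁_ _⊑₂_ : Rel (Multirel X Y) (lsuc 0ℓ)} →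
    IsPreorderedCommDoubleMonoid _≋_ _⊑₁_ _⋓_ 1⋓ _⋒_ 1⋒ →
    IsPreorderedCommDoubleMonoid _≋_ _⊑₂_ _⋓_ 1⋓ _⋒_ 1⋒ →
    IsPreorderedCommDoubleMonoid _≋_ (_⊑₁_ ∩₂ _⊑₂_) _⋓_ 1⋓ _⋒_ 1⋒
  isPreorderedCommDoubleMonoid-∩ {_⊑₁_} {_⊑₂_} M₁ M₂ = isPreorderedCommDoubleMonoid
    (Intersection.isPreorder M₁.isPreorder M₂.isPreorder)
    (monotone₂-∩ {_⊑₁_ = _⊑₁_} {_⊑₂_} {_⋓_} M₁.∙-mono M₂.∙-mono)
    (monotone₂-∩ {_⊑₁_ = _⊑₁_} {_⊑₂_} {_⋒_} M₁.∘-mono M₂.∘-mono)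
    where module M₁ = IsPreorderedCommDoubleMonoid M₁; module M₂ = IsPreorderedCommDoubleMonoid M₂

module Down {Y : Set} = LiftingProperties {Y} ⊆-isPreorder
module Up   {Y : Set} = LiftingProperties {Y} (Flip.isPreorder ⊆-isPreorder)

module _ {X Y : Set} where

  ⊑↓-isPreorder : IsPreorder _≋_ (_⊑↓_ {X} {Y})
  ⊑↓-isPreorder = Down.lifting-isPreorder

  ⊑↑-isPreorder : IsPreorder _≋_ (_⊑↑_ {X} {Y})
  ⊑↑-isPreorder = Flip.isPreorder Up.lifting-isPreorder

  ⊑↕-isPreorder : IsPreorder _≋_ (_⊑↕_ {X} {Y})
  ⊑↕-isPreorder = Intersection.isPreorder ⊑↓-isPreorder ⊑↑-isPreorder

  ⊆ᴹ-↓ᴹ : {R : Multirel X Y} → R ⊆ᴹ ↓ᴹ R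
  ⊆ᴹ-↓ᴹ {R} = Down.lifting-refl {P = rel R}

  ⊆ᴹ-↑ᴹ : {R : Multirel X Y} → R ⊆ᴹ ↑ᴹ R
  ⊆ᴹ-↑ᴹ {R} = Up.lifting-refl {P = rel R}

  ⊆ᴹ-↕ᴹ : {R : Multirel X Y} → R ⊆ᴹ ↕ᴹ R
  ⊆ᴹ-↕ᴹ {R} r = ⊆ᴹ-↑ᴹ {R} r , ⊆ᴹ-↓ᴹ {R} r

  -- ↓ᴹ R and ↕ᴹ R are ⊑↓-equivalent to R, and ↑ᴹ R and ↕ᴹ R are ⊑↑-equivalent to R;
  -- only the remaining closure needs an argument (through unions, resp. intersections).
  ⊑↓-precongruence : Precongruence X Y _⊑↓_
  ⊑↓-precongruence =
      Down.∪₂-lifting-mono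
    , Down.below-flip-lifting-mono (λ A B → A ∪ B , inj₁ , inj₂)
    , (λ {R} {S} → id-equivalent⇒monotone ⊑↓-isPreorder {↓ᴹ}
         (λ _ → id) (λ R → Down.lifting-reflexive {P = rel R} (⊆ᴹ-↓ᴹ {R})) {R} {S})
    , (λ {R} {S} → id-equivalent⇒monotone ⊑↓-isPreorder {↕ᴹ}
         (λ _ → proj₂) (λ R → Down.lifting-reflexive {P = rel R} (⊆ᴹ-↕ᴹ {R})) {R} {S})

  ⊑↑-precongruence : Precongruence X Y _⊑↑_
  ⊑↑-precongruence =
      (λ {R} {R′} {S} {S′} → Up.∪₂-lifting-mono {P = rel R′} {rel R} {rel S′} {rel S})
    , (λ {R} {S} → id-equivalent⇒monotone ⊑↑-isPreorder {↑ᴹ}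
         (λ R → Up.lifting-reflexive {P = rel R} (⊆ᴹ-↑ᴹ {R})) (λ _ → id) {R} {S})
    , (λ {R} {S} → Up.below-flip-lifting-mono (λ A B → A ∩ B , proj₁ , proj₂) {rel S} {rel R})
    , (λ {R} {S} → id-equivalent⇒monotone ⊑↑-isPreorder {↕ᴹ}
         (λ R → Up.lifting-reflexive {P = rel R} (⊆ᴹ-↕ᴹ {R})) (λ _ → proj₁) {R} {S})

  ⊑↓-isPreorderedCommDoubleMonoid : IsPreorderedCommDoubleMonoid _≋_ (_⊑↓_ {X} {Y}) _⋓_ 1⋓ _⋒_ 1⋒
  ⊑↓-isPreorderedCommDoubleMonoid = isPreorderedCommDoubleMonoid ⊑↓-isPreorder
    (Down.inner-lifting-mono ∪-mono-⊆) (Down.inner-lifting-mono ∩-mono-⊆)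

  ⊑↑-isPreorderedCommDoubleMonoid : IsPreorderedCommDoubleMonoid _≋_ (_⊑↑_ {X} {Y}) _⋓_ 1⋓ _⋒_ 1⋒
  ⊑↑-isPreorderedCommDoubleMonoid = isPreorderedCommDoubleMonoid ⊑↑-isPreorder
    (Up.inner-lifting-mono ∪-mono-⊆) (Up.inner-lifting-mono ∩-mono-⊆)

  ⊑↕-isPreorderedCommDoubleMonoid : IsPreorderedCommDoubleMonoid _≋_ (_⊑↕_ {X} {Y}) _⋓_ 1⋓ _⋒_ 1⋒
  ⊑↕-isPreorderedCommDoubleMonoid =
    isPreorderedCommDoubleMonoid-∩ ⊑↓-isPreorderedCommDoubleMonoid ⊑↑-isPreorderedCommDoubleMonoid

  ⊑↕-precongruence : Precongruence X Y _⊑↕_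
  ⊑↕-precongruence = precongruence-∩ {_⊑₁_ = _⊑↓_} {_⊑↑_} ⊑↓-precongruence ⊑↑-precongruence

module _ {X Y : Set} where

  ∼-antitone-⊑↓ : {R S : Multirel X Y} → R ⊑↓ S → (∼ S) ⊑↑ (∼ R)
  ∼-antitone-⊑↓ {R = R} {S} = Down.image-lifting-antitone {P = rel R} {rel S} ∁-antitone

  ∼-antitone-⊑↑ : {R S : Multirel X Y} → R ⊑↑ S → (∼ S) ⊑↓ (∼ R)
  ∼-antitone-⊑↑ {R = R} {S} = Up.image-lifting-antitone {P = rel S} {rel R} ∁-antitone

module _ (em : ExcludedMiddle 0ℓ) {X Y : Set} where

  ∼-reflects-⊑↓ : {R S : Multirel X Y} → (∼ S) ⊑↑ (∼ R) → R ⊑↓ S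
  ∼-reflects-⊑↓ {R} {S} = Down.image-lifting-reflects {P = rel R} {rel S} (∁-reflects-⊆ em)

  ∼-reflects-⊑↑ : {R S : Multirel X Y} → (∼ S) ⊑↓ (∼ R) → R ⊑↑ S
  ∼-reflects-⊑↑ {R} {S} = Up.image-lifting-reflects {P = rel S} {rel R} (∁-reflects-⊆ em)

  complementation-isAntiIsomorphism : Part4 X Y
  complementation-isAntiIsomorphism =
      (λ {R} {S} (R⊆S , S⊆R) →
         image-map ∁-cong {rel R} {rel S} R⊆S , image-map ∁-cong {rel S} {rel R} S⊆R)
    , (λ R → image-involutive ∁-cong (λ _ → ∁-involutive em) (resp R))
    , (λ R S → image-inner ∁-cong (λ _ _ → ∁-∪) ∩-cong)
    , (λ R S → image-inner ∁-cong (λ _ _ → ∁-∩ em) ∪-cong)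
    , image-constant ∁-cong ∁-∅
    , image-constant ∁-cong ∁-U
    , λ R S →
        mk⇔ (∼-antitone-⊑↓ {R = R} {S}) (∼-reflects-⊑↓ {R} {S})
      , mk⇔ (∼-antitone-⊑↑ {R = R} {S}) (∼-reflects-⊑↑ {R} {S})
      , mk⇔ (λ (R⊑↓S , R⊑↑S) → ∼-antitone-⊑↑ {R = R} {S} R⊑↑S , ∼-antitone-⊑↓ {R = R} {S} R⊑↓S)
            (λ (∼S⊑↓∼R , ∼S⊑↑∼R) → ∼-reflects-⊑↓ {R} {S} ∼S⊑↑∼R , ∼-reflects-⊑↑ {R} {S} ∼S⊑↓∼R)

peleg-monotoneʳ : ExcludedMiddle 0ℓ → Part6
peleg-monotoneʳ em W X Y R {S} {T} =
  ⊑↓-mono , ⊑↑-mono , λ (S⊑↓T , S⊑↑T) → ⊑↓-mono S⊑↓T , ⊑↑-mono S⊑↑T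
  where
  ⊑↓-mono : S ⊑↓ T → (R ✱ S) ⊑↓ (R ✱ T)
  ⊑↓-mono = Down.peleg-lifting-mono em ⋃-mono-⊆ {rel R} {rel S} {rel T}
  ⊑↑-mono : S ⊑↑ T → (R ✱ S) ⊑↑ (R ✱ T)
  ⊑↑-mono = Up.peleg-lifting-mono em ⋃-mono-⊆ {rel R} {rel T} {rel S}

proposition5p3 : ((X Y : Set) → Part1 X Y × Part2 X Y × Part3 X Y
                               × (ExcludedMiddle 0ℓ → Part4 X Y) × Part5 X Y)
                 × (ExcludedMiddle 0ℓ → Part6)
proposition5p3 =
    (λ X Y →
        (⊑↓-isPreorderedCommDoubleMonoid , (λ _ ()) , λ R → Down.lifting-to-Uᴹ {P = rel R})
      , (⊑↑-isPreorderedCommDoubleMonoid , (λ R → Up.lifting-to-Uᴹ {P = rel R}) , λ _ ())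
      , ⊑↕-isPreorderedCommDoubleMonoid
      , (λ em → complementation-isAntiIsomorphism em)
      , (⊑↓-precongruence , ⊑↑-precongruence , ⊑↕-precongruence))
  , peleg-monotoneʳ
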